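{- Suppose that $n,k, d_1, d_2, \ldots, d_k$ are positive integers, $k > 1$, and $1 \leq d_1 < d_2 < \cdots < d_k \leq n/2$. Suppose that $n$ is even and each $d_i$ is odd. Let $D=\{d_1, \ldots, d_k\}$. Then $\chi(C_n, D)=2$.
   Context: $C_n$ is the cycle with vertex set $\mathbb{Z}_n=\{0,1,\dots,n-1\}$, $i$ adjacent to $i\pm1 \pmod n$; the graph distance is $\mathrm{dist}(i,j)=\min(|i-j|,\,n-|i-j|)$. For a set $D$ of positive integers, the distance graph $G(C_n,D)$ has vertex set $\mathbb{Z}_n$, with distinct $i,j$ adjacent iff $\mathrm{dist}(i,j)\in D$; $\chi(C_n,D)$ is its chromatic number. -}

module Defs where

open import Data.Nat using (ℕ; _∸_; _≤_; _<_; _⊓_; _*_; suc)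
open import Data.Nat.Properties using ()
open import Data.Nat using (∣_-_∣)
open import Data.Fin using (Fin; toℕ)
open import Data.Product using (Σ; _×_; ∃)
open import Relation.Binary.PropositionalEquality using (_≡_; _≢_)

cycDist : (n : ℕ) → Fin n → Fin n → ℕ
cycDist n i j = ∣ toℕ i - toℕ j ∣ ⊓ (n ∸ ∣ toℕ i - toℕ j ∣)

Adj : (n : ℕ) → (ℕ → Set) → Fin n → Fin n → Set
Adj n D i j = (i ≢ j) × D (cycDist n i j)

ProperColouring : (n : ℕ) → (ℕ → Set) → (c : ℕ) → (Fin n → Fin c) → Set
ProperColouring n D c f = ∀ i j → Adj n D i j → f i ≢ f j

Colourable : (n : ℕ) → (ℕ → Set) → ℕ → Set
Colourable n D c = Σ (Fin n → Fin c) (ProperColouring n D c)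

ChromaticNumber : (n : ℕ) → (ℕ → Set) → ℕ → Set
ChromaticNumber n D c = Colourable n D c × (∀ m → Colourable n D m → c ≤ m)

InImage : {k : ℕ} → (Fin k → ℕ) → ℕ → Set
InImage {k} d x = ∃ λ (i : Fin k) → d i ≡ x

-- Colour each vertex by the parity of its label. Since n is even, both arcs
-- between two vertices of equal parity have even length, so the cycle distance
-- of a monochromatic pair is even and never lies in D. Conversely the single
-- distance d₁ ≤ n/2 already joins 0 to d₁, so one colour is not enough.

module Submission where

open import Defs
open import Data.Nat using (ℕ; zero; suc; _≤_; _<_; _*_; _+_; _∸_; _⊓_; ∣_-_∣; parity; z≤n; s≤s)
open import Data.Nat.Properties
  using (⊓-sel; m≤n⇒m⊓n≡m; m+n≤o⇒m≤o∸n; m<m+n; +-identityʳ; <-≤-trans; <⇒≢)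
open import Data.Parity.Base as ℙ using (Parity; 0ℙ; 1ℙ; _⁻¹)
open import Data.Parity.Properties using (suc-homo-⁻¹; +-homo-+; *-homo-*)
open import Data.Fin using (Fin; toℕ; zero; suc; fromℕ<)
open import Data.Fin.Properties using (toℕ-fromℕ<)
open import Data.Product using (∃; _,_; proj₂)
open import Data.Sum using (inj₁; inj₂)
open import Data.Empty using (⊥-elim)
open import Relation.Binary.PropositionalEquality using (_≡_; _≢_; refl; sym; trans; cong; subst)

parity-2*m : ∀ m → parity (2 * m) ≡ 0ℙ
parity-2*m m = *-homo-* 2 m

parity-2*m+1 : ∀ m → parity (2 * m + 1) ≡ 1ℙ
parity-2*m+1 m = trans (+-homo-+ (2 * m) 1) (cong (ℙ._+ 1ℙ) (parity-2*m m))

parity-pred : ∀ m n → parity (suc m) ≡ parity (suc n) → parity m ≡ parity n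
parity-pred m n eq = trans (sym (suc-homo-⁻¹ m)) (trans (cong _⁻¹ eq) (suc-homo-⁻¹ n))

same-parity⇒∸-even : ∀ m n → parity m ≡ parity n → parity (m ∸ n) ≡ 0ℙ
same-parity⇒∸-even m       zero    eq = eq
same-parity⇒∸-even zero    (suc n) eq = refl
same-parity⇒∸-even (suc m) (suc n) eq = same-parity⇒∸-even m n (parity-pred m n eq)

same-parity⇒∣-∣-even : ∀ m n → parity m ≡ parity n → parity ∣ m - n ∣ ≡ 0ℙ
same-parity⇒∣-∣-even zero    n       eq = sym eq
same-parity⇒∣-∣-even (suc m) zero    eq = eq
same-parity⇒∣-∣-even (suc m) (suc n) eq = same-parity⇒∣-∣-even m n (parity-pred m n eq)

⊓-pres : ∀ (P : ℕ → Set) m n → P m → P n → P (m ⊓ n)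
⊓-pres P m n pm pn with ⊓-sel m n
... | inj₁ m⊓n≡m = subst P (sym m⊓n≡m) pm
... | inj₂ m⊓n≡n = subst P (sym m⊓n≡n) pn

same-parity⇒cycDist-even : ∀ {n} (i j : Fin n) → parity n ≡ 0ℙ →
  parity (toℕ i) ≡ parity (toℕ j) → parity (cycDist n i j) ≡ 0ℙ
same-parity⇒cycDist-even {n} i j n-even same =
  ⊓-pres (λ x → parity x ≡ 0ℙ) δ (n ∸ δ)
    δ-even (same-parity⇒∸-even n δ (trans n-even (sym δ-even)))
  where
  δ : ℕ
  δ = ∣ toℕ i - toℕ j ∣
  δ-even : parity δ ≡ 0ℙ
  δ-even = same-parity⇒∣-∣-even (toℕ i) (toℕ j) same

colour : Parity → Fin 2
colour 0ℙ = zero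
colour 1ℙ = suc zero

colour-injective : ∀ {p q} → colour p ≡ colour q → p ≡ q
colour-injective {0ℙ} {0ℙ} _ = refl
colour-injective {1ℙ} {1ℙ} _ = refl

parityColouring : (n : ℕ) → Fin n → Fin 2
parityColouring n i = colour (parity (toℕ i))

parityColouring-proper : ∀ {n} {D : ℕ → Set} → parity n ≡ 0ℙ →
  (∀ x → D x → parity x ≡ 1ℙ) → ProperColouring n D 2 (parityColouring n)
parityColouring-proper n-even D-odd i j (_ , Dx) same with
  trans (sym (D-odd _ Dx)) (same-parity⇒cycDist-even i j n-even (colour-injective same))
... | ()

adjacent-to-zero : ∀ {n} {D : ℕ → Set} d → D d → 0 < d → 2 * d ≤ suc n →
  ∃ λ (j : Fin (suc n)) → Adj (suc n) D zero j
adjacent-to-zero {n} {D} d Dd 0<d 2d≤n = j , zero≢j , subst D (sym dist≡d) Dd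
  where
  d+d≤n : d + d ≤ suc n
  d+d≤n = subst (λ x → d + x ≤ suc n) (+-identityʳ d) 2d≤n
  d<n : d < suc n
  d<n = <-≤-trans (m<m+n d 0<d) d+d≤n
  j : Fin (suc n)
  j = fromℕ< d<n
  zero≢j : zero ≢ j
  zero≢j eq = <⇒≢ 0<d (trans (cong toℕ eq) (toℕ-fromℕ< d<n))
  dist≡d : cycDist (suc n) zero j ≡ d
  dist≡d rewrite toℕ-fromℕ< d<n = m≤n⇒m⊓n≡m (m+n≤o⇒m≤o∸n d d+d≤n)

edge⇒2≤colours : ∀ {n D m} {i j : Fin n} → Adj n D i j → Colourable n D m → 2 ≤ m
edge⇒2≤colours {m = zero} {i} _ (f , _) with f i
... | ()
edge⇒2≤colours {m = suc zero} {i} {j} ij-edge (f , proper) =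
  ⊥-elim (proper i j ij-edge (Fin1-≡ (f i) (f j)))
  where
  Fin1-≡ : (a b : Fin 1) → a ≡ b
  Fin1-≡ zero zero = refl
edge⇒2≤colours {m = suc (suc _)} _ _ = s≤s (s≤s z≤n)

proposition3p3p2 : (n k : ℕ) → (d : Fin k → ℕ) →
    1 ≤ n → 1 < k →
    (∀ (i j : Fin k) → toℕ i < toℕ j → d i < d j) →
    (∀ (i : Fin k) → 1 ≤ d i) →
    (∀ (i : Fin k) → 2 * d i ≤ n) →
    (∃ λ m → n ≡ 2 * m) →
    (∀ (i : Fin k) → ∃ λ m → d i ≡ 2 * m + 1) →
    ChromaticNumber n (InImage d) 2
proposition3p3p2 (suc n) (suc k) d _ _ _ d-pos 2d≤n (h , n≡2h) d-odd =
  (parityColouring (suc n) , parityColouring-proper n-even D-odd) ,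
  λ _ → edge⇒2≤colours {D = InImage d} edge
  where
  n-even : parity (suc n) ≡ 0ℙ
  n-even = trans (cong parity n≡2h) (parity-2*m h)
  D-odd : ∀ x → InImage d x → parity x ≡ 1ℙ
  D-odd x (i , refl) with d-odd i
  ... | m , di≡2m+1 = trans (cong parity di≡2m+1) (parity-2*m+1 m)
  edge : Adj (suc n) (InImage d) zero _
  edge = proj₂ (adjacent-to-zero {D = InImage d} (d zero) (zero , refl) (d-pos zero) (2d≤n zero))
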